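{- For each prime number $p$ there exists $\widehat\alpha\in\Delta_{\mathcal H_p}$ (regarded as an element of $\widehat\Delta_{\mathcal H}$) such that the set $\Gamma_{\mathcal H}\backslash\eta_{\mathcal H}^{ -1}(\widehat\Gamma_{\mathcal H}\widehat\alpha\widehat\Gamma_{\mathcal H})/\Gamma_{\mathcal H}$ has more than one element.
   Context: The Heisenberg Lie algebra $\mathcal H$ is the quotient of the free Lie algebra over $\mathbb Z$ on two generators by $[L_2,[L_2,L_2]]$. $\Delta_{\mathcal H}=\mathrm{End}^{alg}_{\mathbb Z}(\mathcal H)\cap\mathrm{Aut}^{alg}_{\mathbb Q}(\mathcal H\otimes\mathbb Q)$ and $\Gamma_{\mathcal H}=\mathrm{Aut}^{alg}_{\mathbb Z}(\mathcal H)$ are identified with $(M_2(\mathbb Z)\cap GL_2(\mathbb Q))\times\mathbb Z^2$ and $GL_2(\mathbb Z)\times\mathbb Z^2$ in the group $GL_2(\mathbb Q)\times\mathbb Q^2$ with product $(A,\mathbf a)(B,\mathbf b)=(AB,A\mathbf b+\det(B)\mathbf a)$; for each prime $q$, $\Delta_{\mathcal H_q}=(M_2(\mathbb Z_q)\cap GL_2(\mathbb Q_q))\times\mathbb Z_q^2$, $\Gamma_{\mathcal H_q}=GL_2(\mathbb Z_q)\times\mathbb Z_q^2$ with the same product. $\widehat\Gamma_{\mathcal H}=\prod_q\Gamma_{\mathcal H_q}$; $\widehat\Delta_{\mathcal H}$ is the set of $(\alpha_q)\in\prod_q\Delta_{\mathcal H_q}$ with $\alpha_q\in\Gamma_{\mathcal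 H_q}$ for almost all $q$; $\Delta_{\mathcal H_p}\subset\widehat\Delta_{\mathcal H}$ by putting the identity in the components $q\ne p$. $\eta_{\mathcal H}:\Delta_{\mathcal H}\to\widehat\Delta_{\mathcal H}$ is the diagonal embedding. -}

module Defs where

open import Data.Bool using (if_then_else_)
open import Data.Nat as ℕ using (ℕ; suc; _^_)
open import Data.Nat.Primality using (Prime)
open import Data.Integer as ℤ using (ℤ; +_; 0ℤ; 1ℤ)
open import Data.Integer.Divisibility using (_∣_)
open import Data.Product using (Σ; _×_; _,_; ∃; ∃-syntax)
open import Relation.Nullary using (¬_; ⌊_⌋)
open import Relation.Binary.PropositionalEquality using (_≡_)

module HeisGroup {C : Set} (_+_ _*_ : C → C → C) (-_ : C → C) where

  record M2 : Set where
    constructor mat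
    field a b c d : C

  record V2 : Set where
    constructor vec
    field x y : C

  det : M2 → C
  det (mat a b c d) = (a * d) + (- (b * c))

  _·M_ : M2 → M2 → M2
  mat a b c d ·M mat a' b' c' d' =
    mat ((a * a') + (b * c')) ((a * b') + (b * d'))
        ((c * a') + (d * c')) ((c * b') + (d * d'))

  _·MV_ : M2 → V2 → V2
  mat a b c d ·MV vec x y = vec ((a * x) + (b * y)) ((c * x) + (d * y))

  _·S_ : C → V2 → V2
  s ·S vec x y = vec (s * x) (s * y)

  _+V_ : V2 → V2 → V2
  vec x y +V vec x' y' = vec (x + x') (y + y')

  H : Set
  H = M2 × V2

  _∙_ : H → H → H
  (A , u) ∙ (B , v) = (A ·M B , (A ·MV v) +V (det B ·S u))

  detH : H → C
  detH (A , _) = det A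

  AllEntries : (C → Set) → H → Set
  AllEntries P (mat a b c d , vec x y) =
    P a × P b × P c × P d × P x × P y

  Pointwise : (C → C → Set) → H → H → Set
  Pointwise R (mat a b c d , vec x y) (mat a' b' c' d' , vec x' y') =
    R a a' × R b b' × R c c' × R d d' × R x x' × R y y'

module HZ = HeisGroup ℤ._+_ ℤ._*_ ℤ.-_

-- Δ_H : integral matrices, invertible over ℚ (det ≠ 0), integral vector
Δ-H : HZ.H → Set
Δ-H δ = ¬ (HZ.detH δ ≡ 0ℤ)

-- Γ_H = GL₂(ℤ) × ℤ² : det a unit of ℤ
Γ-H : HZ.H → Set
Γ-H γ = ∃[ u ] (HZ.detH γ ℤ.* u ≡ 1ℤ)

-- q-adic integers ℤ_q as the inverse limit of ℤ/q^n:
-- coherent sequences x : ℕ → ℤ (x (n+1) ≡ x n mod q^n),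
-- two sequences equal iff x n ≡ y n mod q^n for all n.

ℤq-raw : Set
ℤq-raw = ℕ → ℤ

IsZq : ℕ → ℤq-raw → Set
IsZq q x = ∀ n → (+ (q ^ n)) ∣ (x (suc n) ℤ.- x n)

_≈[_]_ : ℤq-raw → ℕ → ℤq-raw → Set
x ≈[ q ] y = ∀ n → (+ (q ^ n)) ∣ (x n ℤ.- y n)

_+q_ : ℤq-raw → ℤq-raw → ℤq-raw
(x +q y) n = x n ℤ.+ y n

_*q_ : ℤq-raw → ℤq-raw → ℤq-raw
(x *q y) n = x n ℤ.* y n

-q_ : ℤq-raw → ℤq-raw
(-q x) n = ℤ.- x n

ιℤ : ℤ → ℤq-raw
ιℤ z _ = z

module HQ = HeisGroup _+q_ _*q_ -q_

-- Δ_{H_q} = (M₂(ℤ_q) ∩ GL₂(ℚ_q)) × ℤ_q² : integral entries, det ≠ 0 in ℤ_q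
Δ-Hq : ℕ → HQ.H → Set
Δ-Hq q α = HQ.AllEntries (IsZq q) α × ¬ (HQ.detH α ≈[ q ] ιℤ 0ℤ)

-- Γ_{H_q} = GL₂(ℤ_q) × ℤ_q² : integral entries, det a unit of ℤ_q
Γ-Hq : ℕ → HQ.H → Set
Γ-Hq q γ = HQ.AllEntries (IsZq q) γ
         × ∃[ u ] (IsZq q u × ((HQ.detH γ *q u) ≈[ q ] ιℤ 1ℤ))

_≈H[_]_ : HQ.H → ℕ → HQ.H → Set
α ≈H[ q ] β = HQ.Pointwise (λ x y → x ≈[ q ] y) α β

-- diagonal component of η_H at q
ηq : HZ.H → HQ.H
ηq (HZ.mat a b c d , HZ.vec x y) = (HQ.mat (ιℤ a) (ιℤ b) (ιℤ c) (ιℤ d) , HQ.vec (ιℤ x) (ιℤ y))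

oneQ : HQ.H
oneQ = (HQ.mat (ιℤ 1ℤ) (ιℤ 0ℤ) (ιℤ 0ℤ) (ιℤ 1ℤ) , HQ.vec (ιℤ 0ℤ) (ιℤ 0ℤ))

-- α ∈ Δ_{H_p} regarded as an element of Δ̂_H: component at q
inclusion : ℕ → HQ.H → ℕ → HQ.H
inclusion p α q = if ⌊ q ℕ.≟ p ⌋ then α else oneQ

-- η_H(δ) ∈ Γ̂_H α̂ Γ̂_H  (componentwise over all primes q; the elements of
-- Γ̂_H are the families (γ_q) with γ_q ∈ Γ_{H_q})
InDoubleCoset : ℕ → HQ.H → HZ.H → Set
InDoubleCoset p α δ =
  (q : ℕ) → Prime q →
    ∃[ γ₁ ] ∃[ γ₂ ] (Γ-Hq q γ₁ × Γ-Hq q γ₂ ×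
      (ηq δ ≈H[ q ] ((γ₁ HQ.∙ inclusion p α q) HQ.∙ γ₂)))

InPreimage : ℕ → HQ.H → HZ.H → Set
InPreimage p α δ = Δ-H δ × InDoubleCoset p α δ

SameΓDoubleCoset : HZ.H → HZ.H → Set
SameΓDoubleCoset δ₁ δ₂ =
  ∃[ γ₁ ] ∃[ γ₂ ] (Γ-H γ₁ × Γ-H γ₂ × (δ₁ ≡ (γ₁ HZ.∙ δ₂) HZ.∙ γ₂))

-- At every prime q ≠ p the elements δ_b = (diag(N, N³), (1, N b)), N = p³, have unit
-- determinant N⁴, so η(δ_b) ∈ Γ_{H_q}. At p, for b a p-adic unit with inverse s (built by
-- Newton iteration), diag(s, 1) · δ_1 · diag(b, 1) ≡ δ_b; hence δ_1 and δ_{1+p} both lie in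
-- η⁻¹(Γ̂ α̂ Γ̂) for α̂ = δ_1 at p. But δ_a = g δ_b h with g, h ∈ Γ_H forces a ≡ ±b (mod N),
-- and 1 ≢ ±(1 + p) (mod p³).

module Submission where

open import Defs
open import Data.Nat using (ℕ)
open import Data.Nat.Primality using (Prime)
open import Data.Product using (_×_; ∃-syntax)
open import Relation.Nullary using (¬_)

open import Data.Nat as ℕ using (zero; suc; _^_; z≤n; s≤s)
import Data.Nat.Properties as ℕ
import Data.Nat.Divisibility as ℕ
open import Data.Nat.Primality using (prime⇒irreducible; prime⇒nonTrivial; prime⇒nonZero)
open import Data.Nat.Coprimality using (Coprime; coprime-Bézout)
open import Data.Nat.GCD using (module Bézout)
open import Data.Integer as ℤ using (ℤ; +_; -[1+_]; 0ℤ; 1ℤ; -1ℤ; _+_; _*_; -_; _-_; ∣_∣)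
open import Data.Integer.Properties
  using ( abs-*; pos-*; i*j≢0; *-comm; *-zeroʳ; *-identityˡ; *-identityʳ; *-cancelˡ-≡
        ; +-identityʳ; +-inverseʳ; -1*i≡-i; neg-involutive; ∣i∣≡0⇒i≡0 )
import Data.Integer.Divisibility as Unsigned
open import Data.Integer.Divisibility.Signed
open import Data.Integer.Tactic.RingSolver
open import Data.List using (_∷_; [])
open import Data.Product using (_,_; proj₁; proj₂)
open import Data.Sum using (_⊎_; inj₁; inj₂; [_,_]′)
open import Function using (_∘_)
open import Relation.Binary.PropositionalEquality
open import Relation.Nullary using (contradiction; yes; no)

*≡1⇒≡±1 : ∀ x u → x * u ≡ 1ℤ → x ≡ 1ℤ ⊎ x ≡ -1ℤ
*≡1⇒≡±1 x u xu≡1 with ℕ.m*n≡1⇒m≡1 ∣ x ∣ ∣ u ∣ (trans (sym (abs-* x u)) (cong ∣_∣ xu≡1))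
*≡1⇒≡±1 (+ .1)      _ _ | refl = inj₁ refl
*≡1⇒≡±1 -[1+ 0 ]    _ _ | refl = inj₂ refl

*-pres-∣ : ∀ {i j k l} → i ∣ j → k ∣ l → i * k ∣ j * l
*-pres-∣ {j = j} {k} i∣j k∣l = ∣-trans (*-monoˡ-∣ k i∣j) (*-monoʳ-∣ j k∣l)

∣x-x : ∀ {k} x → k ∣ x - x
∣x-x {k} x = divides 0ℤ (+-inverseʳ x)

n<m^n : ∀ {m} n → 1 ℕ.< m → n ℕ.< m ^ n
n<m^n zero    _   = s≤s z≤n
n<m^n {m} (suc n) 1<m = ℕ.≤-<-trans (n<m^n n 1<m) m^n<m^[1+n]
  where
  instance _ = ℕ.m^n≢0 m n {{ℕ.>-nonZero (ℕ.<-trans (s≤s z≤n) 1<m)}}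
  m^n<m^[1+n] : m ^ n ℕ.< m ℕ.* m ^ n
  m^n<m^[1+n] = subst (m ^ n ℕ.<_) (ℕ.*-comm (m ^ n) m) (ℕ.m<m*n (m ^ n) m 1<m)

≡+multiple⇒∣- : ∀ {x} y k z → x ≡ y + k * z → k ∣ x - y
≡+multiple⇒∣- {x} y k z eq = divides z (begin
  x - y             ≡⟨ cong (_- y) eq ⟩
  (y + k * z) - y   ≡⟨ solve (k ∷ y ∷ z ∷ []) ⟩
  z * k             ∎)
  where open ≡-Reasoning

InvertibleMod : ℕ → ℤ → Set
InvertibleMod q m = ∃[ a ] (+ q ∣ 1ℤ - m * a)

invertibleMod-* : ∀ {q} m n → InvertibleMod q m → InvertibleMod q n → InvertibleMod q (m * n)
invertibleMod-* {q} m n (a , q∣1-ma) (b , q∣1-nb) = a * b , (begin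
  + q                             ∣⟨ ∣m∣n⇒∣m+n q∣1-ma (∣n⇒∣m*n (m * a) q∣1-nb) ⟩
  1ℤ - m * a + m * a * (1ℤ - n * b) ≡⟨ solve (m ∷ n ∷ a ∷ b ∷ []) ⟩
  1ℤ - m * n * (a * b)            ∎)
  where open ∣-Reasoning

private
  bézout-+- : ∀ m x y q → 1ℤ + y * q ≡ x * m → 1ℤ - m * x ≡ - y * q
  bézout-+- m x y q eq = begin
    1ℤ - m * x          ≡⟨ cong (λ z → 1ℤ - z) (*-comm m x) ⟩
    1ℤ - x * m          ≡⟨ cong (λ z → 1ℤ - z) eq ⟨
    1ℤ - (1ℤ + y * q)   ≡⟨ solve (y ∷ q ∷ []) ⟩
    - y * q             ∎
    where open ≡-Reasoning

  bézout--+ : ∀ m x y q → 1ℤ + x * m ≡ y * q → 1ℤ - m * (- x) ≡ y * q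
  bézout--+ m x y q eq = begin
    1ℤ - m * (- x) ≡⟨ solve (m ∷ x ∷ []) ⟩
    1ℤ + x * m     ≡⟨ eq ⟩
    y * q          ∎
    where open ≡-Reasoning

  pos-identity : ∀ a b c d → 1 ℕ.+ a ℕ.* b ≡ c ℕ.* d → 1ℤ + + a * + b ≡ + c * + d
  pos-identity a b c d eq =
    trans (cong (λ z → 1ℤ + z) (sym (pos-* a b))) (trans (cong +_ eq) (pos-* c d))

coprime⇒invertibleMod : ∀ {m q} → Coprime m q → InvertibleMod q (+ m)
coprime⇒invertibleMod {m} {q} c with coprime-Bézout c
... | Bézout.+- x y eq = + x , divides (- + y) (bézout-+- (+ m) (+ x) (+ y) (+ q) (pos-identity y q x m eq))
... | Bézout.-+ x y eq = - + x , divides (+ y) (bézout--+ (+ m) (+ x) (+ y) (+ q) (pos-identity x m y q eq))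

distinct-primes-coprime : ∀ {p q} → Prime p → Prime q → p ≢ q → Coprime p q
distinct-primes-coprime {p} {q} prime-p prime-q p≢q (d∣p , d∣q)
  with prime⇒irreducible prime-q d∣q
... | inj₁ d≡1 = d≡1
... | inj₂ refl with prime⇒irreducible prime-p d∣p
...   | inj₁ q≡1 = contradiction q≡1 (ℕ.nonTrivial⇒≢1 {{prime⇒nonTrivial prime-q}})
...   | inj₂ q≡p = contradiction (sym q≡p) p≢q

invertibleMod-1 : ∀ {q} → InvertibleMod q 1ℤ
invertibleMod-1 = 1ℤ , divides 0ℤ refl

invertibleMod-1+q : ∀ q → InvertibleMod q (1ℤ + + q)
invertibleMod-1+q q = 1ℤ , divides -1ℤ (unit-shift (+ q))
  where
  unit-shift : ∀ x → 1ℤ - (1ℤ + x) * 1ℤ ≡ -1ℤ * x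
  unit-shift = solve-∀

IsZq-ιℤ : ∀ q z → IsZq q (ιℤ z)
IsZq-ιℤ q z n = ∣⇒∣ᵤ (∣x-x {+ (q ^ n)} z)

-- Newton's iteration w ↦ w + w (1 - m w) squares the error 1 - m w.
newton : ℤ → ℤ → ℕ → ℤ
newton m a zero    = a
newton m a (suc n) = w + w * (1ℤ - m * w)
  where w = newton m a n

private
  newton-step-error : ∀ m w → (1ℤ - m * w) * (1ℤ - m * w) ≡ 1ℤ - m * (w + w * (1ℤ - m * w))
  newton-step-error = solve-∀

  newton-step-difference : ∀ m w → w * (1ℤ - m * w) ≡ (w + w * (1ℤ - m * w)) - w
  newton-step-difference = solve-∀

  neg-error : ∀ m w → - (1ℤ - m * w) ≡ m * w - 1ℤ
  neg-error = solve-∀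

module _ {q : ℕ} (m a : ℤ) (q∣1-ma : + q ∣ 1ℤ - m * a) where

  private
    q^n∣q^[1+n] : ∀ n → + (q ^ n) ∣ + (q ^ suc n)
    q^n∣q^[1+n] n = ∣ᵤ⇒∣ {+ (q ^ n)} (ℕ.n∣m*n q)

  newton-error : ∀ n → + (q ^ suc n) ∣ 1ℤ - m * newton m a n
  newton-error zero    = subst (λ k → + k ∣ 1ℤ - m * a) (sym (ℕ.*-identityʳ q)) q∣1-ma
  newton-error (suc n) = begin
    + (q ℕ.* q ^ suc n)             ≡⟨ pos-* q (q ^ suc n) ⟩
    + q * + (q ^ suc n)             ∣⟨ *-pres-∣ q∣error (newton-error n) ⟩
    (1ℤ - m * w) * (1ℤ - m * w)     ≡⟨ newton-step-error m w ⟩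
    1ℤ - m * (w + w * (1ℤ - m * w)) ∎
    where
    open ∣-Reasoning
    w = newton m a n
    q∣error : + q ∣ 1ℤ - m * w
    q∣error = ∣-trans (∣ᵤ⇒∣ {+ q} (ℕ.m∣m*n (q ^ n))) (newton-error n)

  newton-IsZq : IsZq q (newton m a)
  newton-IsZq n = ∣⇒∣ᵤ (begin
    + (q ^ n)                           ∣⟨ ∣-trans (q^n∣q^[1+n] n) (∣n⇒∣m*n w (newton-error n)) ⟩
    w * (1ℤ - m * w)                    ≡⟨ newton-step-difference m w ⟩
    (w + w * (1ℤ - m * w)) - w          ∎)
    where
    open ∣-Reasoning
    w = newton m a n

  newton-inverse : (ιℤ m *q newton m a) ≈[ q ] ιℤ 1ℤ
  newton-inverse n = ∣⇒∣ᵤ (begin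
    + (q ^ n)              ∣⟨ ∣m⇒∣-m (∣-trans (q^n∣q^[1+n] n) (newton-error n)) ⟩
    - (1ℤ - m * w)         ≡⟨ neg-error m w ⟩
    m * w - 1ℤ             ∎)
    where
    open ∣-Reasoning
    w = newton m a n

invertibleMod⇒ℤq-unit : ∀ {q m} → InvertibleMod q m →
                        ∃[ w ] (IsZq q w × (ιℤ m *q w) ≈[ q ] ιℤ 1ℤ)
invertibleMod⇒ℤq-unit {q} {m} (a , q∣1-ma) =
  newton m a , newton-IsZq m a q∣1-ma , newton-inverse m a q∣1-ma

ιℤ-≉0 : ∀ {q z} → 1 ℕ.< q → z ≢ 0ℤ → ¬ (ιℤ z ≈[ q ] ιℤ 0ℤ)
ιℤ-≉0 {q} {z} 1<q z≢0 z≈0 = ℕ.<⇒≱ (n<m^n ∣ z ∣ 1<q) (ℕ.∣⇒≤ q^∣z∣∣z)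
  where
  instance _ = ℕ.≢-nonZero (z≢0 ∘ ∣i∣≡0⇒i≡0)
  q^∣z∣∣z : q ^ ∣ z ∣ ℕ.∣ ∣ z ∣
  q^∣z∣∣z = subst (λ x → q ^ ∣ z ∣ ℕ.∣ ∣ x ∣) (+-identityʳ z) (z≈0 ∣ z ∣)

oneZ : HZ.H
oneZ = HZ.mat 1ℤ 0ℤ 0ℤ 1ℤ , HZ.vec 0ℤ 0ℤ

diagZ : ℤ → HZ.H
diagZ s = HZ.mat s 0ℤ 0ℤ 1ℤ , HZ.vec 0ℤ 0ℤ

diagQ : ℤq-raw → HQ.H
diagQ s = HQ.mat s (ιℤ 0ℤ) (ιℤ 0ℤ) (ιℤ 1ℤ) , HQ.vec (ιℤ 0ℤ) (ιℤ 0ℤ)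

mat-≡ : ∀ {a b c d a′ b′ c′ d′} → a ≡ a′ → b ≡ b′ → c ≡ c′ → d ≡ d′ →
        HZ.mat a b c d ≡ HZ.mat a′ b′ c′ d′
mat-≡ refl refl refl refl = refl

vec-≡ : ∀ {x y x′ y′} → x ≡ x′ → y ≡ y′ → HZ.vec x y ≡ HZ.vec x′ y′
vec-≡ refl refl = refl

∙-identityˡ : ∀ δ → oneZ HZ.∙ δ ≡ δ
∙-identityˡ (HZ.mat a b c d , HZ.vec x y) =
  cong₂ _,_ (mat-≡ (first a c) (first b d) (second a c) (second b d))
            (vec-≡ (first-shifted x y (a * d - b * c)) (second-shifted x y (a * d - b * c)))
  where
  first : ∀ u v → 1ℤ * u + 0ℤ * v ≡ u
  first = solve-∀
  second : ∀ u v → 0ℤ * u + 1ℤ * v ≡ v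
  second = solve-∀
  first-shifted : ∀ u v D → (1ℤ * u + 0ℤ * v) + D * 0ℤ ≡ u
  first-shifted = solve-∀
  second-shifted : ∀ u v D → (0ℤ * u + 1ℤ * v) + D * 0ℤ ≡ v
  second-shifted = solve-∀

_≡H_[mod_] : HZ.H → HZ.H → ℕ → Set
δ ≡H δ′ [mod m ] = HZ.Pointwise (λ x y → + m ∣ x - y) δ δ′

≡⇒≡H : ∀ {δ δ′ m} → δ ≡ δ′ → δ ≡H δ′ [mod m ]
≡⇒≡H {HZ.mat a b c d , HZ.vec x y} refl = ∣x-x a , ∣x-x b , ∣x-x c , ∣x-x d , ∣x-x x , ∣x-x y

-- Truncation at level n; it commutes with the group law definitionally, so q-adic
-- congruences are checked as integer congruences modulo q ^ n.
level : ℕ → HQ.H → HZ.H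
level n (HQ.mat a b c d , HQ.vec x y) = HZ.mat (a n) (b n) (c n) (d n) , HZ.vec (x n) (y n)

≈H-from-levels : ∀ {q α β} → (∀ n → level n α ≡H level n β [mod q ^ n ]) → α ≈H[ q ] β
≈H-from-levels h =
  (λ n → ∣⇒∣ᵤ (proj₁ (h n))) ,
  (λ n → ∣⇒∣ᵤ (proj₁ (proj₂ (h n)))) ,
  (λ n → ∣⇒∣ᵤ (proj₁ (proj₂ (proj₂ (h n))))) ,
  (λ n → ∣⇒∣ᵤ (proj₁ (proj₂ (proj₂ (proj₂ (h n)))))) ,
  (λ n → ∣⇒∣ᵤ (proj₁ (proj₂ (proj₂ (proj₂ (proj₂ (h n))))))) ,
  (λ n → ∣⇒∣ᵤ (proj₂ (proj₂ (proj₂ (proj₂ (proj₂ (h n)))))))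

diagQ-Γ : ∀ {q} s t → IsZq q s → IsZq q t → (t *q s) ≈[ q ] ιℤ 1ℤ → Γ-Hq q (diagQ s)
diagQ-Γ {q} s t s∈ℤq t∈ℤq ts≈1 =
  (s∈ℤq , IsZq-ιℤ q 0ℤ , IsZq-ιℤ q 0ℤ , IsZq-ιℤ q 1ℤ , IsZq-ιℤ q 0ℤ , IsZq-ιℤ q 0ℤ) ,
  t , t∈ℤq , λ n → subst (λ z → + (q ^ n) Unsigned.∣ z - 1ℤ) (det-diag (s n) (t n)) (ts≈1 n)
  where
  det-diag : ∀ s t → t * s ≡ (s * 1ℤ + - (0ℤ * 0ℤ)) * t
  det-diag = solve-∀

oneQ-Γ : ∀ {q} → Γ-Hq q oneQ
oneQ-Γ {q} = diagQ-Γ (ιℤ 1ℤ) (ιℤ 1ℤ) (IsZq-ιℤ q 1ℤ) (IsZq-ιℤ q 1ℤ) (λ n → ∣⇒∣ᵤ (∣x-x {+ (q ^ n)} 1ℤ))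

ηq-IsZq : ∀ q δ → HQ.AllEntries (IsZq q) (ηq δ)
ηq-IsZq q (HZ.mat a b c d , HZ.vec x y) =
  IsZq-ιℤ q a , IsZq-ιℤ q b , IsZq-ιℤ q c , IsZq-ιℤ q d , IsZq-ιℤ q x , IsZq-ιℤ q y

ηq-Γ : ∀ {q} δ → InvertibleMod q (HZ.detH δ) → Γ-Hq q (ηq δ)
ηq-Γ {q} δ inv = ηq-IsZq q δ , invertibleMod⇒ℤq-unit {q} {HZ.detH δ} inv

LocalDoubleCoset : ℕ → HQ.H → HQ.H → Set
LocalDoubleCoset q α β = ∃[ γ₁ ] ∃[ γ₂ ] (Γ-Hq q γ₁ × Γ-Hq q γ₂ × (β ≈H[ q ] ((γ₁ HQ.∙ α) HQ.∙ γ₂)))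

-- (oneQ ∙ oneQ) ∙ ηq δ is ηq (oneZ ∙ δ) at every level, oneZ ∙ oneZ being closed.
unit-LocalDoubleCoset : ∀ {q} δ → InvertibleMod q (HZ.detH δ) → LocalDoubleCoset q oneQ (ηq δ)
unit-LocalDoubleCoset {q} δ inv =
  oneQ , ηq δ , oneQ-Γ , ηq-Γ δ inv ,
  ≈H-from-levels {q} {ηq δ} {(oneQ HQ.∙ oneQ) HQ.∙ ηq δ} (λ n → ≡⇒≡H (sym (∙-identityˡ δ)))

rep : ℤ → ℤ → HZ.H
rep N a = HZ.mat N 0ℤ 0ℤ (N * N * N) , HZ.vec 1ℤ (N * a)

det-rep : ∀ N a → HZ.detH (rep N a) ≡ N * (N * N * N)
det-rep N a = +-identityʳ (N * (N * N * N))

det-rep≢0 : ∀ N a .{{_ : ℤ.NonZero N}} → HZ.detH (rep N a) ≢ 0ℤ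
det-rep≢0 N a det≡0 =
  ℕ.≢-nonZero⁻¹ ∣ N * (N * N * N) ∣ (cong ∣_∣ (trans (sym (det-rep N a)) det≡0))
  where
  instance
    _ = i*j≢0 N N
    _ = i*j≢0 (N * N) N
    _ = i*j≢0 N (N * N * N)

invertibleMod-det-rep : ∀ {q} N a → InvertibleMod q N → InvertibleMod q (HZ.detH (rep N a))
invertibleMod-det-rep N a N-unit = subst (InvertibleMod _) (sym (det-rep N a))
  (invertibleMod-* N (N * N * N) N-unit (invertibleMod-* (N * N) N (invertibleMod-* N N N-unit N-unit) N-unit))

rep-twist : ∀ {m} N s c → + m ∣ c * s - 1ℤ →
            rep N c ≡H (diagZ s HZ.∙ rep N 1ℤ) HZ.∙ diagZ c [mod m ]
rep-twist {m} N s c m∣cs-1 =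
  multiple (- N) a , null b , null c′ , null d , multiple -1ℤ x , null y
  where
  multiple : ∀ {z} k → z ≡ k * (c * s - 1ℤ) → + m ∣ z
  multiple k eq = subst (+ m ∣_) (sym eq) (∣n⇒∣m*n k m∣cs-1)
  null : ∀ {z} → z ≡ 0ℤ → + m ∣ z
  null eq = subst (+ m ∣_) (sym eq) (divides 0ℤ refl)
  -- the six entries, with the product written as the group law unfolds it
  a : N - ((s * N + 0ℤ * 0ℤ) * c + (s * 0ℤ + 0ℤ * (N * N * N)) * 0ℤ) ≡ - N * (c * s - 1ℤ)
  a = solve (N ∷ s ∷ c ∷ [])
  b : 0ℤ - ((s * N + 0ℤ * 0ℤ) * 0ℤ + (s * 0ℤ + 0ℤ * (N * N * N)) * 1ℤ) ≡ 0ℤ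
  b = solve (N ∷ s ∷ [])
  c′ : 0ℤ - ((0ℤ * N + 1ℤ * 0ℤ) * c + (0ℤ * 0ℤ + 1ℤ * (N * N * N)) * 0ℤ) ≡ 0ℤ
  c′ = solve (N ∷ c ∷ [])
  d : N * N * N - ((0ℤ * N + 1ℤ * 0ℤ) * 0ℤ + (0ℤ * 0ℤ + 1ℤ * (N * N * N)) * 1ℤ) ≡ 0ℤ
  d = solve (N ∷ [])
  x : 1ℤ - (((s * N + 0ℤ * 0ℤ) * 0ℤ + (s * 0ℤ + 0ℤ * (N * N * N)) * 0ℤ)
            + (c * 1ℤ + - (0ℤ * 0ℤ)) * ((s * 1ℤ + 0ℤ * (N * 1ℤ)) + (N * (N * N * N) + - (0ℤ * 0ℤ)) * 0ℤ))
      ≡ -1ℤ * (c * s - 1ℤ)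
  x = solve (N ∷ s ∷ c ∷ [])
  y : N * c - (((0ℤ * N + 1ℤ * 0ℤ) * 0ℤ + (0ℤ * 0ℤ + 1ℤ * (N * N * N)) * 0ℤ)
            + (c * 1ℤ + - (0ℤ * 0ℤ)) * ((0ℤ * 1ℤ + 1ℤ * (N * 1ℤ)) + (N * (N * N * N) + - (0ℤ * 0ℤ)) * 0ℤ))
      ≡ 0ℤ
  y = solve (N ∷ c ∷ [])

rep-LocalDoubleCoset : ∀ {q} N c → InvertibleMod q c → LocalDoubleCoset q (ηq (rep N 1ℤ)) (ηq (rep N c))
rep-LocalDoubleCoset {q} N c inv = twisted (invertibleMod⇒ℤq-unit {q} {c} inv)
  where
  twisted : ∃[ w ] (IsZq q w × (ιℤ c *q w) ≈[ q ] ιℤ 1ℤ) → LocalDoubleCoset q (ηq (rep N 1ℤ)) (ηq (rep N c))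
  twisted (w , w∈ℤq , cw≈1) =
    diagQ w , diagQ (ιℤ c) , diagQ-Γ w (ιℤ c) w∈ℤq (IsZq-ιℤ q c) cw≈1 ,
    diagQ-Γ (ιℤ c) w (IsZq-ιℤ q c) w∈ℤq (λ n → subst (λ z → + (q ^ n) Unsigned.∣ z - 1ℤ) (*-comm c (w n)) (cw≈1 n)) ,
    ≈H-from-levels {q} {ηq (rep N c)} {(diagQ w HQ.∙ ηq (rep N 1ℤ)) HQ.∙ diagQ (ιℤ c)}
      (λ n → rep-twist N (w n) c (∣ᵤ⇒∣ (cw≈1 n)))

rep-InDoubleCoset : ∀ {p N} b → (∀ {q} → Prime q → q ≢ p → InvertibleMod q N) → InvertibleMod p b →
                    InDoubleCoset p (ηq (rep N 1ℤ)) (rep N b)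
rep-InDoubleCoset {p} {N} b N-unit b-unit q prime-q with q ℕ.≟ p
... | yes refl = rep-LocalDoubleCoset N b b-unit
... | no q≢p   = unit-LocalDoubleCoset (rep N b) (invertibleMod-det-rep N b (N-unit prime-q q≢p))

-- An invariant of Γ_H-double cosets

cramer : ∀ G₁₁ G₁₂ G₂₁ G₂₂ x y →
         G₁₁ * x + G₁₂ * y ≡ 1ℤ → G₂₁ * x + G₂₂ * y ≡ 0ℤ →
         G₂₁ ≡ - (y * (G₁₁ * G₂₂ - G₁₂ * G₂₁))
cramer G₁₁ G₁₂ G₂₁ G₂₂ x y row₁ row₂ = begin
  G₂₁                                                        ≡⟨ solve (G₁₁ ∷ G₂₁ ∷ []) ⟩
  G₂₁ * 1ℤ - G₁₁ * 0ℤ                                        ≡⟨ cong₂ (λ u v → G₂₁ * u - G₁₁ * v) row₁ row₂ ⟨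
  G₂₁ * (G₁₁ * x + G₁₂ * y) - G₁₁ * (G₂₁ * x + G₂₂ * y)      ≡⟨ solve (G₁₁ ∷ G₁₂ ∷ G₂₁ ∷ G₂₂ ∷ x ∷ y ∷ []) ⟩
  - (y * (G₁₁ * G₂₂ - G₁₂ * G₂₁))                            ∎
  where open ≡-Reasoning

±1-cases : ∀ {k} a b {e d} → e ≡ 1ℤ ⊎ e ≡ -1ℤ → d ≡ 1ℤ ⊎ d ≡ -1ℤ →
           k ∣ a - e * e * d * b → (k ∣ a - b) ⊎ (k ∣ a + b)
±1-cases {k} a b (inj₁ refl) = ±1-case
  where
  ±1-case : ∀ {d} → d ≡ 1ℤ ⊎ d ≡ -1ℤ → k ∣ a - 1ℤ * d * b → (k ∣ a - b) ⊎ (k ∣ a + b)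
  ±1-case (inj₁ refl) k∣ = inj₁ (subst (λ z → k ∣ a - z) (*-identityˡ b) k∣)
  ±1-case (inj₂ refl) k∣ = inj₂ (subst (λ z → k ∣ a + z) (trans (cong -_ (-1*i≡-i b)) (neg-involutive b)) k∣)
±1-cases {k} a b (inj₂ refl) = ±1-cases a b (inj₁ refl)

-- Entries (1,1), (2,1) and the vector part of (g · rep N b) · h, as the group law unfolds them.
private
  matrix-entry : ∀ N P Q H₁₁ H₂₁ →
    N * (P * H₁₁ + Q * (N * N * H₂₁)) ≡ (P * N + Q * 0ℤ) * H₁₁ + (P * 0ℤ + Q * (N * N * N)) * H₂₁
  matrix-entry = solve-∀

  vector-entry : ∀ N b e P Q u w₁ w₂ →
    ((P * N + Q * 0ℤ) * w₁ + (P * 0ℤ + Q * (N * N * N)) * w₂)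
      + e * ((P * 1ℤ + Q * (N * b)) + (N * (N * N * N) + - (0ℤ * 0ℤ)) * u)
    ≡ e * P + N * (e * Q * b + P * w₁ + N * (Q * N * w₂ + e * N * N * u))
  vector-entry = solve-∀

  second-row : ∀ N a B G w₁ W e → N * a ≡ e * G + N * (B + G * w₁ + N * W) →
               N * (a - B) ≡ e * G + N * (G * w₁ + N * W)
  second-row N a B G w₁ W e eq = begin
    N * (a - B)                              ≡⟨ solve (N ∷ a ∷ B ∷ []) ⟩
    N * a - N * B                            ≡⟨ cong (_- N * B) eq ⟩
    e * G + N * (B + G * w₁ + N * W) - N * B ≡⟨ solve (N ∷ B ∷ G ∷ w₁ ∷ W ∷ e ∷ []) ⟩
    e * G + N * (G * w₁ + N * W)             ∎
    where open ≡-Reasoning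

  determinant-split : ∀ a b e G₁₁ G₁₂ G₂₁ G₂₂ →
    (a - e * G₂₂ * b) + e * G₂₂ * b * (1ℤ - e * G₁₁) + e * e * b * G₁₂ * G₂₁
    ≡ a - e * e * (G₁₁ * G₂₂ - G₁₂ * G₂₁) * b
  determinant-split = solve-∀

-- With e = det h: the first column of rep N a = (g · rep N b) · h gives N² ∣ G₂₁ (Cramer),
-- the vector part gives e G₁₁ ≡ 1 and e G₂₂ b ≡ a (mod N), so e² det(g) b ≡ a (mod N).
rep-sameΓDoubleCoset : ∀ N a b .{{_ : ℤ.NonZero N}} →
  SameΓDoubleCoset (rep N a) (rep N b) → (N ∣ a - b) ⊎ (N ∣ a + b)
rep-sameΓDoubleCoset N a b
  ((HZ.mat G₁₁ G₁₂ G₂₁ G₂₂ , HZ.vec u₁ u₂) , (HZ.mat H₁₁ H₁₂ H₂₁ H₂₂ , HZ.vec w₁ w₂) ,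
   (g⁻ , det-g-unit) , (h⁻ , det-h-unit) , eq) =
  ±1-cases a b (*≡1⇒≡±1 e h⁻ det-h-unit) (*≡1⇒≡±1 (G₁₁ * G₂₂ - G₁₂ * G₂₁) g⁻ det-g-unit)
    (subst (N ∣_) (determinant-split a b e G₁₁ G₁₂ G₂₁ G₂₂)
      (∣m∣n⇒∣m+n (∣m∣n⇒∣m+n N∣a-eG₂₂b (∣n⇒∣m*n (e * G₂₂ * b) N∣1-eG₁₁))
                 (∣n⇒∣m*n (e * e * b * G₁₂) N∣G₂₁)))
  where
  e : ℤ
  e = H₁₁ * H₂₂ - H₁₂ * H₂₁

  column₁ : G₁₁ * H₁₁ + G₁₂ * (N * N * H₂₁) ≡ 1ℤ
  column₁ = *-cancelˡ-≡ N _ _ (trans (matrix-entry N G₁₁ G₁₂ H₁₁ H₂₁)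
              (trans (sym (cong (HZ.M2.a ∘ proj₁) eq)) (sym (*-identityʳ N))))

  column₂ : G₂₁ * H₁₁ + G₂₂ * (N * N * H₂₁) ≡ 0ℤ
  column₂ = *-cancelˡ-≡ N _ _ (trans (matrix-entry N G₂₁ G₂₂ H₁₁ H₂₁)
              (trans (sym (cong (HZ.M2.c ∘ proj₁) eq)) (sym (*-zeroʳ N))))

  N²∣G₂₁ : N * N ∣ G₂₁
  N²∣G₂₁ = subst (N * N ∣_) (sym (cramer G₁₁ G₁₂ G₂₁ G₂₂ H₁₁ (N * N * H₂₁) column₁ column₂))
             (∣m⇒∣-m (∣m⇒∣m*n (G₁₁ * G₂₂ - G₁₂ * G₂₁) (∣m⇒∣m*n H₂₁ ∣-refl)))

  N∣G₂₁ : N ∣ G₂₁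
  N∣G₂₁ = ∣-trans (∣m⇒∣m*n N ∣-refl) N²∣G₂₁

  N∣1-eG₁₁ : N ∣ 1ℤ - e * G₁₁
  N∣1-eG₁₁ = ≡+multiple⇒∣- (e * G₁₁) N _
               (trans (cong (HZ.V2.x ∘ proj₂) eq) (vector-entry N b e G₁₁ G₁₂ u₁ w₁ w₂))

  N∣a-eG₂₂b : N ∣ a - e * G₂₂ * b
  N∣a-eG₂₂b = *-cancelˡ-∣ N (subst (N * N ∣_) (sym (second-row N a (e * G₂₂ * b) G₂₁ w₁ W e row₂)) N²∣rhs)
    where
    W = G₂₂ * N * w₂ + e * N * N * u₂
    row₂ = trans (cong (HZ.V2.y ∘ proj₂) eq) (vector-entry N b e G₂₁ G₂₂ u₂ w₁ w₂)
    N²∣rhs : N * N ∣ e * G₂₁ + N * (G₂₁ * w₁ + N * W)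
    N²∣rhs = ∣m∣n⇒∣m+n (∣n⇒∣m*n e N²∣G₂₁)
                       (*-monoʳ-∣ N (∣m∣n⇒∣m+n (∣m⇒∣m*n w₁ N∣G₂₁) (∣m⇒∣m*n W ∣-refl)))

-- N = p² would not do: for p = 2 it divides 1 + (1 + p).
cube : ℕ → ℤ
cube p = + p * + p * + p

cube≢0 : ∀ p .{{_ : ℕ.NonZero p}} → ℤ.NonZero (cube p)
cube≢0 p = i*j≢0 (+ p * + p) (+ p) {{i*j≢0 (+ p) (+ p)}}

invertibleMod-cube : ∀ {q} p → InvertibleMod q (+ p) → InvertibleMod q (cube p)
invertibleMod-cube p p-unit =
  invertibleMod-* (+ p * + p) (+ p) (invertibleMod-* (+ p) (+ p) p-unit p-unit) p-unit

2+p<p³ : ∀ {p} → 1 ℕ.< p → 2 ℕ.+ p ℕ.< p ℕ.* p ℕ.* p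
2+p<p³ {p} 1<p = begin-strict
  2 ℕ.+ p       ≤⟨ ℕ.+-monoˡ-≤ p 1<p ⟩
  p ℕ.+ p       ≡⟨ cong (p ℕ.+_) (ℕ.+-identityʳ p) ⟨
  2 ℕ.* p       ≤⟨ ℕ.*-monoˡ-≤ p 1<p ⟩
  p ℕ.* p       <⟨ ℕ.m<m*n (p ℕ.* p) p 1<p ⟩
  p ℕ.* p ℕ.* p ∎
  where
  open ℕ.≤-Reasoning
  instance
    _ = ℕ.>-nonZero (ℕ.<-trans (s≤s z≤n) 1<p)
    _ = ℕ.m*n≢0 p p

cube∤ : ∀ {p n} → 1 ℕ.< p → 0 ℕ.< n → n ℕ.≤ 2 ℕ.+ p → ¬ (cube p ∣ + n)
cube∤ {p} {n} 1<p 0<n n≤2+p cube∣n = ℕ.<⇒≱ (2+p<p³ 1<p) (begin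
  p ℕ.* p ℕ.* p   ≡⟨ ∣cube∣ ⟨
  ∣ cube p ∣      ≤⟨ ℕ.∣⇒≤ {{ℕ.>-nonZero 0<n}} (∣⇒∣ᵤ cube∣n) ⟩
  n               ≤⟨ n≤2+p ⟩
  2 ℕ.+ p         ∎)
  where
  open ℕ.≤-Reasoning
  ∣cube∣ : ∣ cube p ∣ ≡ p ℕ.* p ℕ.* p
  ∣cube∣ = trans (abs-* (+ p * + p) (+ p)) (cong (ℕ._* p) (abs-* (+ p) (+ p)))

rep-distinct : ∀ {p} → 1 ℕ.< p → ¬ SameΓDoubleCoset (rep (cube p) 1ℤ) (rep (cube p) (1ℤ + + p))
rep-distinct {p} 1<p same = [ cube∤1-[1+p] , cube∤ 1<p (s≤s z≤n) ℕ.≤-refl ]′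
                              (rep-sameΓDoubleCoset (cube p) 1ℤ (1ℤ + + p) same)
  where
  instance
    _ = ℕ.>-nonZero (ℕ.<-trans (s≤s z≤n) 1<p)
    _ = cube≢0 p
  neg-shift : ∀ x → - (1ℤ - (1ℤ + x)) ≡ x
  neg-shift = solve-∀
  cube∤1-[1+p] : ¬ (cube p ∣ 1ℤ - (1ℤ + + p))
  cube∤1-[1+p] cube∣ = cube∤ 1<p (ℕ.<-trans (s≤s z≤n) 1<p) (ℕ.m≤n+m p 2)
                         (subst (cube p ∣_) (neg-shift (+ p)) (∣m⇒∣-m cube∣))

theorem4p1 : (p : ℕ) → Prime p →
    ∃[ α ] (Δ-Hq p α ×
      ∃[ δ₁ ] ∃[ δ₂ ] (InPreimage p α δ₁ × InPreimage p α δ₂ × ¬ SameΓDoubleCoset δ₁ δ₂))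
theorem4p1 p p-prime =
  ηq (rep N 1ℤ) , (ηq-IsZq p (rep N 1ℤ) , ιℤ-≉0 1<p (det-rep≢0 N 1ℤ)) ,
  rep N 1ℤ , rep N (1ℤ + + p) ,
  (det-rep≢0 N 1ℤ , rep-InDoubleCoset 1ℤ N-unit invertibleMod-1) ,
  (det-rep≢0 N (1ℤ + + p) , rep-InDoubleCoset (1ℤ + + p) N-unit (invertibleMod-1+q p)) ,
  rep-distinct 1<p
  where
  N = cube p
  1<p = ℕ.nonTrivial⇒n>1 p {{prime⇒nonTrivial p-prime}}
  instance
    _ = prime⇒nonZero p-prime
    _ = cube≢0 p
  N-unit : ∀ {q} → Prime q → q ≢ p → InvertibleMod q N
  N-unit prime-q q≢p =
    invertibleMod-cube p (coprime⇒invertibleMod (distinct-primes-coprime p-prime prime-q (q≢p ∘ sym)))
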